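{- (Stretching Theorem) Every graph that admits a grid drawing on a grid of size $W\times H$ also admits a disk-link drawing on a grid of size $2HW\times 2HW$.
   Context: A grid drawing of a simple graph maps each vertex to a distinct point with integer coordinates and each edge to the straight-line segment joining its endpoints, such that no edge segment contains a non-incident vertex. A disk-link drawing of a graph maps each vertex to a distinct open disk of radius $\frac12$ and each edge to the straight-line segment connecting the centers of the disks of its endpoints, such that (i) each disk center has integer coordinates, (ii) no two disks intersect, and (iii) no disk is intersected by the segment of a non-incident edge. A drawing is on a grid of size $W\times H$ if the minimum axis-aligned box containing all vertex points (disk centers) has side lengths $W-1$ (horizontal) and $H-1$ (vertical). -}

module Defs where

open import Data.Nat using (ℕ)
open import Data.Fin using (Fin)
open import Data.Integer as ℤ using (ℤ; +_)
open import Data.Rational as ℚ using (ℚ; 0ℚ; 1ℚ)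
open import Data.Product using (Σ; ∃; _×_; _,_; proj₁; proj₂)
open import Relation.Binary.PropositionalEquality using (_≡_; _≢_)
open import Relation.Nullary using (¬_)
open import Level using (Level; suc; _⊔_) renaming (zero to lzero)

record Graph : Set₁ where
  field
    n      : ℕ
    Adj    : Fin n → Fin n → Set
    sym    : ∀ {u v} → Adj u v → Adj v u
    irrefl : ∀ {u} → ¬ Adj u u
open Graph public

Point : Set
Point = ℤ × ℤ

ι : ℤ → ℚ
ι z = z ℚ./ 1

QPoint : Set
QPoint = ℚ × ℚ

toQ : Point → QPoint
toQ (x , y) = ι x , ι y

along : Point → Point → ℚ → QPoint
along (ax , ay) (bx , by) t =
  (ι ax ℚ.+ t ℚ.* (ι bx ℚ.- ι ax)) , (ι ay ℚ.+ t ℚ.* (ι by ℚ.- ι ay))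

dist² : QPoint → QPoint → ℚ
dist² (px , py) (qx , qy) =
  (px ℚ.- qx) ℚ.* (px ℚ.- qx) ℚ.+ (py ℚ.- qy) ℚ.* (py ℚ.- qy)

-- 1/4 = (radius 1/2)^2
quarter : ℚ
quarter = + 1 ℚ./ 4

OnSegment : Point → Point → Point → Set
OnSegment a b p = Σ ℚ λ t → (0ℚ ℚ.≤ t) × (t ℚ.≤ 1ℚ) × (along a b t ≡ toQ p)

InDisk : Point → QPoint → Set
InDisk c q = dist² q (toQ c) ℚ.< quarter

-- The closed segment [a,b] intersects the open disk of radius 1/2 centred at c.
-- (The intersection is relatively open in the segment, so rational parameters suffice.)
SegmentHitsDisk : Point → Point → Point → Set
SegmentHitsDisk a b c = Σ ℚ λ t → (0ℚ ℚ.≤ t) × (t ℚ.≤ 1ℚ) × InDisk c (along a b t)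

-- The open disks of radius 1/2 centred at c and d intersect.
-- (The intersection is open, so rational points suffice.)
DisksIntersect : Point → Point → Set
DisksIntersect c d = Σ QPoint λ q → InDisk c q × InDisk d q

Injective : ∀ {m} → (Fin m → Point) → Set
Injective {m} p = ∀ (u v : Fin m) → p u ≡ p v → u ≡ v

IsGridDrawing : (G : Graph) → (Fin (n G) → Point) → Set
IsGridDrawing G p =
  Injective p ×
  (∀ u v w → Adj G u v → w ≢ u → w ≢ v → ¬ OnSegment (p u) (p v) (p w))

IsDiskLinkDrawing : (G : Graph) → (Fin (n G) → Point) → Set
IsDiskLinkDrawing G p =
  Injective p ×
  (∀ u v → u ≢ v → ¬ DisksIntersect (p u) (p v)) ×
  (∀ u v w → Adj G u v → w ≢ u → w ≢ v → ¬ SegmentHitsDisk (p u) (p v) (p w))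

xc yc : Point → ℤ
xc = proj₁
yc = proj₂

-- The minimum axis-aligned bounding box of the points has side lengths
-- exactly W-1 (horizontal) and H-1 (vertical).
OnGridOfSize : ∀ {m} → ℕ → ℕ → (Fin m → Point) → Set
OnGridOfSize {m} W H p =
  Σ ℤ λ x₀ → Σ ℤ λ y₀ →
    (∀ v → (x₀ ℤ.≤ xc (p v)) × (xc (p v) ℤ.≤ x₀ ℤ.+ (+ W ℤ.- ℤ.1ℤ))
         × (y₀ ℤ.≤ yc (p v)) × (yc (p v) ℤ.≤ y₀ ℤ.+ (+ H ℤ.- ℤ.1ℤ))) ×
    (Σ (Fin m) λ v → xc (p v) ≡ x₀) ×
    (Σ (Fin m) λ v → xc (p v) ≡ x₀ ℤ.+ (+ W ℤ.- ℤ.1ℤ)) ×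
    (Σ (Fin m) λ v → yc (p v) ≡ y₀) ×
    (Σ (Fin m) λ v → yc (p v) ≡ y₀ ℤ.+ (+ H ℤ.- ℤ.1ℤ))

FitsInGrid : ∀ {m} → ℕ → ℕ → (Fin m → Point) → Set
FitsInGrid {m} W H p =
  Σ ℤ λ x₀ → Σ ℤ λ y₀ →
    (∀ v → (x₀ ℤ.≤ xc (p v)) × (xc (p v) ℤ.≤ x₀ ℤ.+ (+ W ℤ.- ℤ.1ℤ))
         × (y₀ ℤ.≤ yc (p v)) × (yc (p v) ℤ.≤ y₀ ℤ.+ (+ H ℤ.- ℤ.1ℤ)))

module Submission where

open import Defs hiding (sym)
open import Data.Product using (Σ; _×_; _,_; proj₁; proj₂)
open import Data.Sum using (_⊎_; inj₁; inj₂)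
open import Data.Empty using (⊥)
open import Function using (_∘_)
open import Relation.Nullary using (¬_; Dec; yes; no; contradiction)
open import Relation.Binary.PropositionalEquality

-- Stretch the drawing by 2H horizontally and 2W vertically. Distinct integer
-- points are at distance at least 1, so the disks of radius 1/2 are pairwise
-- disjoint, and a vertex collinear with an edge but off it is at distance at
-- least 1 from the edge, whose closest point is then an endpoint. Otherwise
-- twice the area of the triangle spanned by the vertex and the edge is a
-- nonzero integer; stretching multiplies it by (2H)(2W), while the squared
-- length of the edge becomes at most 2(2H)²(2W)², because coordinate
-- differences are below W horizontally and below H vertically. As the squared
-- distance to the line is (area)² / (length)², it is at least 1/2 > 1/4.

module RationalPlane where

  open import Data.Rational
    using (ℚ; 0ℚ; 1ℚ; _+_; _*_; _-_; -_; 1/_; _≤_; _<_; NonZero; ≢-nonZero; >-nonZero; nonNegative; nonPositive; positive)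
  open import Data.Rational.Properties
  open import Data.Rational.Solver using (module +-*-Solver)
  open +-*-Solver using (solve; _:+_; _:*_; _:-_; :-_; _:=_; con)

  1≤p⇒0<p : ∀ {p} → 1ℚ ≤ p → 0ℚ < p
  1≤p⇒0<p = <-≤-trans (positive⁻¹ 1ℚ)

  0≤p*q : ∀ {p q} → 0ℚ ≤ p → 0ℚ ≤ q → 0ℚ ≤ p * q
  0≤p*q {p} {q} 0≤p 0≤q =
    nonNegative⁻¹ _ {{nonNeg*nonNeg⇒nonNeg p {{nonNegative 0≤p}} q {{nonNegative 0≤q}}}}

  0≤p*p : ∀ p → 0ℚ ≤ p * p
  0≤p*p p with ≤-total 0ℚ p
  ... | inj₁ 0≤p = 0≤p*q 0≤p 0≤p
  ... | inj₂ p≤0 = nonNegative⁻¹ _ {{nonPos*nonPos⇒nonPos p {{nonPositive p≤0}} p {{nonPositive p≤0}}}}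

  p≤p+q : ∀ {p q} → 0ℚ ≤ q → p ≤ p + q
  p≤p+q {p} 0≤q = ≤-trans (≤-reflexive (sym (+-identityʳ p))) (+-monoʳ-≤ p 0≤q)

  p≤q+p : ∀ {p q} → 0ℚ ≤ q → p ≤ q + p
  p≤q+p {p} 0≤q = ≤-trans (≤-reflexive (sym (+-identityˡ p))) (+-monoˡ-≤ p 0≤q)

  p≤q*p : ∀ {p q} → 1ℚ ≤ q → 0ℚ ≤ p → p ≤ q * p
  p≤q*p {p} 1≤q 0≤p =
    ≤-trans (≤-reflexive (sym (*-identityˡ p))) (*-monoʳ-≤-nonNeg p {{nonNegative 0≤p}} 1≤q)

  1≤q⇒1≤q*q : ∀ {q} → 1ℚ ≤ q → 1ℚ ≤ q * q
  1≤q⇒1≤q*q 1≤q = ≤-trans 1≤q (p≤q*p 1≤q (<⇒≤ (1≤p⇒0<p 1≤q)))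

  p≤q⇒0≤q-p : ∀ {p q} → p ≤ q → 0ℚ ≤ q - p
  p≤q⇒0≤q-p {p} {q} p≤q = begin
    0ℚ     ≡⟨ +-inverseʳ p ⟨
    p - p  ≤⟨ +-monoˡ-≤ (- p) p≤q ⟩
    q - p  ∎
    where open ≤-Reasoning

  0≤q-p⇒p≤q : ∀ {p q} → 0ℚ ≤ q - p → p ≤ q
  0≤q-p⇒p≤q {p} {q} 0≤q-p = begin
    p            ≡⟨ +-identityʳ p ⟨
    p + 0ℚ       ≤⟨ +-monoʳ-≤ p 0≤q-p ⟩
    p + (q - p)  ≡⟨ solve 2 (λ p q → p :+ (q :- p) := q) refl p q ⟩
    q            ∎
    where open ≤-Reasoning

  diff²≤ : ∀ {p q r} → q - p ≤ r → p - q ≤ r → (q - p) * (q - p) ≤ r * r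
  diff²≤ {p} {q} {r} q-p≤r p-q≤r = 0≤q-p⇒p≤q (begin
    0ℚ                                ≤⟨ 0≤p*q (p≤q⇒0≤q-p q-p≤r) (p≤q⇒0≤q-p p-q≤r) ⟩
    (r - (q - p)) * (r - (p - q))
      ≡⟨ solve 3 (λ p q r → (r :- (q :- p)) :* (r :- (p :- q)) := r :* r :- (q :- p) :* (q :- p)) refl p q r ⟩
    r * r - (q - p) * (q - p)         ∎)
    where open ≤-Reasoning

  *-cancelˡ-≡ : ∀ {p q} r .{{_ : NonZero r}} → r * p ≡ r * q → p ≡ q
  *-cancelˡ-≡ {p} {q} r rp≡rq = begin
    p               ≡⟨ undo p ⟨
    1/ r * (r * p)  ≡⟨ cong (1/ r *_) rp≡rq ⟩
    1/ r * (r * q)  ≡⟨ undo q ⟩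
    q               ∎
    where
    open ≡-Reasoning
    undo : ∀ x → 1/ r * (r * x) ≡ x
    undo x = trans (sym (*-assoc (1/ r) r x))
                   (trans (cong (_* x) (*-inverseˡ r)) (*-identityˡ x))

  p*p≡0⇒p≡0 : ∀ p → p * p ≡ 0ℚ → p ≡ 0ℚ
  p*p≡0⇒p≡0 p pp≡0 with p ≟ 0ℚ
  ... | yes p≡0 = p≡0
  ... | no p≢0 = *-cancelˡ-≡ p {{≢-nonZero p≢0}} (trans pp≡0 (sym (*-zeroʳ p)))

  infixl 6 _⊖_

  _⊖_ : QPoint → QPoint → QPoint
  (px , py) ⊖ (qx , qy) = px - qx , py - qy

  dot cross : QPoint → QPoint → ℚ
  dot (ux , uy) (vx , vy) = ux * vx + uy * vy
  cross (ux , uy) (vx , vy) = ux * vy - uy * vx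

  lerp : QPoint → QPoint → ℚ → QPoint
  lerp (px , py) (qx , qy) t = px + t * (qx - px) , py + t * (qy - py)

  area : QPoint → QPoint → QPoint → ℚ
  area P Q R = cross (P ⊖ R) (Q ⊖ P)

  scale : ℚ → ℚ → QPoint → QPoint
  scale a b (x , y) = a * x , b * y

  0≤dist² : ∀ P Q → 0ℚ ≤ dist² P Q
  0≤dist² (px , py) (qx , qy) = +-mono-≤ (0≤p*p (px - qx)) (0≤p*p (py - qy))

  dist²≡0⇒≡ : ∀ P Q → dist² P Q ≡ 0ℚ → P ≡ Q
  dist²≡0⇒≡ (px , py) (qx , qy) d≡0 = cong₂ _,_
    (coordinate px qx (≤-antisym (≤-trans (p≤p+q (0≤p*p (py - qy))) (≤-reflexive d≡0)) (0≤p*p (px - qx))))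
    (coordinate py qy (≤-antisym (≤-trans (p≤q+p (0≤p*p (px - qx))) (≤-reflexive d≡0)) (0≤p*p (py - qy))))
    where
    coordinate : ∀ p q → (p - q) * (p - q) ≡ 0ℚ → p ≡ q
    coordinate p q e = trans (solve 2 (λ p q → p := (p :- q) :+ q) refl p q)
      (trans (cong (_+ q) (p*p≡0⇒p≡0 (p - q) e)) (+-identityˡ q))

  lagrange : ∀ u v → dot u u * dot v v ≡ dot u v * dot u v + cross u v * cross u v
  lagrange (ux , uy) (vx , vy) = solve 4 (λ ux uy vx vy →
      (ux :* ux :+ uy :* uy) :* (vx :* vx :+ vy :* vy) :=
      (ux :* vx :+ uy :* vy) :* (ux :* vx :+ uy :* vy) :+ (ux :* vy :- uy :* vx) :* (ux :* vy :- uy :* vx))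
    refl ux uy vx vy

  dot-lerp : ∀ P Q R t → dot (lerp P Q t ⊖ R) (Q ⊖ P) ≡ dot (P ⊖ R) (Q ⊖ P) + t * dist² Q P
  dot-lerp (px , py) (qx , qy) (rx , ry) t = solve 7 (λ px py qx qy rx ry t →
      (px :+ t :* (qx :- px) :- rx) :* (qx :- px) :+ (py :+ t :* (qy :- py) :- ry) :* (qy :- py) :=
      (px :- rx) :* (qx :- px) :+ (py :- ry) :* (qy :- py) :+
        t :* ((qx :- px) :* (qx :- px) :+ (qy :- py) :* (qy :- py)))
    refl px py qx qy rx ry t

  area-lerp : ∀ P Q R t → cross (lerp P Q t ⊖ R) (Q ⊖ P) ≡ area P Q R
  area-lerp (px , py) (qx , qy) (rx , ry) t = solve 7 (λ px py qx qy rx ry t →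
      (px :+ t :* (qx :- px) :- rx) :* (qy :- py) :- (py :+ t :* (qy :- py) :- ry) :* (qx :- px) :=
      (px :- rx) :* (qy :- py) :- (py :- ry) :* (qx :- px))
    refl px py qx qy rx ry t

  dist²-lerp-*-dist² : ∀ P Q R t →
    dist² (lerp P Q t) R * dist² Q P ≡
    (dot (P ⊖ R) (Q ⊖ P) + t * dist² Q P) * (dot (P ⊖ R) (Q ⊖ P) + t * dist² Q P) + area P Q R * area P Q R
  dist²-lerp-*-dist² P Q R t = begin
    dist² (lerp P Q t) R * dist² Q P               ≡⟨ lagrange (lerp P Q t ⊖ R) (Q ⊖ P) ⟩
    dot u v * dot u v + cross u v * cross u v      ≡⟨ cong₂ (λ m c → m * m + c * c) (dot-lerp P Q R t) (area-lerp P Q R t) ⟩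
    (dot (P ⊖ R) (Q ⊖ P) + t * dist² Q P) * (dot (P ⊖ R) (Q ⊖ P) + t * dist² Q P) + area P Q R * area P Q R ∎
    where
    open ≡-Reasoning
    u = lerp P Q t ⊖ R
    v = Q ⊖ P

  dist²-lerp : ∀ P Q R t →
    dist² (lerp P Q t) R ≡ dist² P R + t * (dot (P ⊖ R) (Q ⊖ P) + dot (P ⊖ R) (Q ⊖ P) + t * dist² Q P)
  dist²-lerp (px , py) (qx , qy) (rx , ry) t = solve 7 (λ px py qx qy rx ry t →
      (px :+ t :* (qx :- px) :- rx) :* (px :+ t :* (qx :- px) :- rx) :+
        (py :+ t :* (qy :- py) :- ry) :* (py :+ t :* (qy :- py) :- ry) :=
      (px :- rx) :* (px :- rx) :+ (py :- ry) :* (py :- ry) :+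
        t :* ((px :- rx) :* (qx :- px) :+ (py :- ry) :* (qy :- py) :+
              ((px :- rx) :* (qx :- px) :+ (py :- ry) :* (qy :- py)) :+
              t :* ((qx :- px) :* (qx :- px) :+ (qy :- py) :* (qy :- py))))
    refl px py qx qy rx ry t

  lerp-swap : ∀ P Q t → lerp P Q t ≡ lerp Q P (1ℚ - t)
  lerp-swap (px , py) (qx , qy) t = cong₂ _,_ (coordinate px qx) (coordinate py qy)
    where
    coordinate : ∀ p q → p + t * (q - p) ≡ q + (1ℚ - t) * (p - q)
    coordinate p q = solve 3 (λ p q t → p :+ t :* (q :- p) := q :+ (con 1ℚ :- t) :* (p :- q)) refl p q t

  area²≤dist²-lerp-*-dist² : ∀ P Q R t → area P Q R * area P Q R ≤ dist² (lerp P Q t) R * dist² Q P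
  area²≤dist²-lerp-*-dist² P Q R t = begin
    area P Q R * area P Q R          ≤⟨ p≤q+p (0≤p*p m) ⟩
    m * m + area P Q R * area P Q R  ≡⟨ dist²-lerp-*-dist² P Q R t ⟨
    dist² (lerp P Q t) R * dist² Q P ∎
    where
    open ≤-Reasoning
    m = dot (P ⊖ R) (Q ⊖ P) + t * dist² Q P

  dist²-start≤ : ∀ P Q R t → 0ℚ ≤ dot (P ⊖ R) (Q ⊖ P) → 0ℚ ≤ t → dist² P R ≤ dist² (lerp P Q t) R
  dist²-start≤ P Q R t 0≤K 0≤t = begin
    dist² P R
      ≤⟨ p≤p+q (0≤p*q 0≤t (+-mono-≤ (+-mono-≤ 0≤K 0≤K) (0≤p*q 0≤t (0≤dist² Q P)))) ⟩
    dist² P R + t * (K + K + t * dist² Q P)           ≡⟨ dist²-lerp P Q R t ⟨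
    dist² (lerp P Q t) R                              ∎
    where
    open ≤-Reasoning
    K = dot (P ⊖ R) (Q ⊖ P)

  dist²-end≤ : ∀ P Q R t → 0ℚ ≤ dot (Q ⊖ R) (P ⊖ Q) → t ≤ 1ℚ → dist² Q R ≤ dist² (lerp P Q t) R
  dist²-end≤ P Q R t 0≤K′ t≤1 =
    subst (λ X → dist² Q R ≤ dist² X R) (sym (lerp-swap P Q t))
      (dist²-start≤ Q P R (1ℚ - t) 0≤K′ (p≤q⇒0≤q-p t≤1))

  -- The foot of the perpendicular from R is at parameter -K / L, where both
  -- squares in dist²-lerp-*-dist² vanish.
  lerp-hits : ∀ P Q R → area P Q R ≡ 0ℚ →
    dot (P ⊖ R) (Q ⊖ P) < 0ℚ → dot (Q ⊖ R) (P ⊖ Q) < 0ℚ →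
    Σ ℚ λ t → 0ℚ ≤ t × t ≤ 1ℚ × lerp P Q t ≡ R
  lerp-hits P Q R area≡0 K<0 K′<0 = t , 0≤t , t≤1 , dist²≡0⇒≡ (lerp P Q t) R dist²≡0
    where
    K = dot (P ⊖ R) (Q ⊖ P)
    K′ = dot (Q ⊖ R) (P ⊖ Q)
    L = dist² Q P
    -K≡K′+L : - K ≡ K′ + L
    -K≡K′+L = identity P Q R
      where
      identity : ∀ P Q R → - dot (P ⊖ R) (Q ⊖ P) ≡ dot (Q ⊖ R) (P ⊖ Q) + dist² Q P
      identity (px , py) (qx , qy) (rx , ry) = solve 6 (λ px py qx qy rx ry →
          :- ((px :- rx) :* (qx :- px) :+ (py :- ry) :* (qy :- py)) :=
          (qx :- rx) :* (px :- qx) :+ (qy :- ry) :* (py :- qy) :+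
            ((qx :- px) :* (qx :- px) :+ (qy :- py) :* (qy :- py)))
        refl px py qx qy rx ry
    0<L : 0ℚ < L
    0<L = begin-strict
      0ℚ      <⟨ neg-antimono-< K<0 ⟩
      - K     ≡⟨ -K≡K′+L ⟩
      K′ + L  <⟨ +-monoˡ-< L K′<0 ⟩
      0ℚ + L  ≡⟨ +-identityˡ L ⟩
      L       ∎
      where open ≤-Reasoning
    instance
      L≢0 : NonZero L
      L≢0 = >-nonZero 0<L
    t = - K * 1/ L
    t*L≡-K : t * L ≡ - K
    t*L≡-K = trans (*-assoc (- K) (1/ L) L) (trans (cong (- K *_) (*-inverseˡ L)) (*-identityʳ (- K)))
    0≤t : 0ℚ ≤ t
    0≤t = *-cancelʳ-≤-pos L {{positive 0<L}} (begin
      0ℚ * L ≡⟨ *-zeroˡ L ⟩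
      0ℚ     ≤⟨ neg-antimono-≤ (<⇒≤ K<0) ⟩
      - K    ≡⟨ t*L≡-K ⟨
      t * L  ∎)
      where open ≤-Reasoning
    t≤1 : t ≤ 1ℚ
    t≤1 = *-cancelʳ-≤-pos L {{positive 0<L}} (begin
      t * L   ≡⟨ t*L≡-K ⟩
      - K     ≡⟨ -K≡K′+L ⟩
      K′ + L  ≤⟨ +-monoˡ-≤ L (<⇒≤ K′<0) ⟩
      0ℚ + L  ≡⟨ +-identityˡ L ⟩
      L       ≡⟨ *-identityˡ L ⟨
      1ℚ * L  ∎)
      where open ≤-Reasoning
    dist²≡0 : dist² (lerp P Q t) R ≡ 0ℚ
    dist²≡0 = *-cancelˡ-≡ L (begin
      L * dist² (lerp P Q t) R                  ≡⟨ *-comm L _ ⟩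
      dist² (lerp P Q t) R * L                  ≡⟨ dist²-lerp-*-dist² P Q R t ⟩
      (K + t * L) * (K + t * L) + area P Q R * area P Q R
                                                ≡⟨ cong₂ (λ m a → m * m + a * a) K+t*L≡0 area≡0 ⟩
      0ℚ                                        ≡⟨ *-zeroʳ L ⟨
      L * 0ℚ                                    ∎)
      where
      open ≡-Reasoning
      K+t*L≡0 : K + t * L ≡ 0ℚ
      K+t*L≡0 = trans (cong (K +_) t*L≡-K) (+-inverseʳ K)

  -- If dot (P ⊖ R) (Q ⊖ P) ≥ 0 then R lies behind P and P is the point of the
  -- segment closest to R; symmetrically for Q; otherwise R lies on the segment.
  collinear-segment-clear : ∀ {ρ} P Q R → ρ ≤ dist² P R → ρ ≤ dist² Q R → area P Q R ≡ 0ℚ →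
    (∀ t → 0ℚ ≤ t → t ≤ 1ℚ → lerp P Q t ≢ R) →
    ∀ t → 0ℚ ≤ t → t ≤ 1ℚ → ρ ≤ dist² (lerp P Q t) R
  collinear-segment-clear {ρ} P Q R ρ≤PR ρ≤QR area≡0 misses t 0≤t t≤1 =
    by-position (0ℚ ≤? dot (P ⊖ R) (Q ⊖ P)) (0ℚ ≤? dot (Q ⊖ R) (P ⊖ Q))
    where
    by-position : Dec (0ℚ ≤ dot (P ⊖ R) (Q ⊖ P)) → Dec (0ℚ ≤ dot (Q ⊖ R) (P ⊖ Q)) → ρ ≤ dist² (lerp P Q t) R
    by-position (yes 0≤K) _         = ≤-trans ρ≤PR (dist²-start≤ P Q R t 0≤K 0≤t)
    by-position (no _)    (yes 0≤K′) = ≤-trans ρ≤QR (dist²-end≤ P Q R t 0≤K′ t≤1)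
    by-position (no 0≰K)  (no 0≰K′) =
      let s , 0≤s , s≤1 , hits = lerp-hits P Q R area≡0 (≰⇒> 0≰K) (≰⇒> 0≰K′) in
      contradiction hits (misses s 0≤s s≤1)

  line-segment-clear : ∀ {ρ} P Q R → 0ℚ < dist² Q P → ρ * dist² Q P ≤ area P Q R * area P Q R →
    ∀ t → ρ ≤ dist² (lerp P Q t) R
  line-segment-clear P Q R 0<L ρL≤area² t =
    *-cancelʳ-≤-pos (dist² Q P) {{positive 0<L}} (≤-trans ρL≤area² (area²≤dist²-lerp-*-dist² P Q R t))

  dist²≤double-sum : ∀ P R Z → dist² P R ≤ (dist² Z P + dist² Z R) + (dist² Z P + dist² Z R)
  dist²≤double-sum (px , py) (rx , ry) (zx , zy) = begin
    dist² (px , py) (rx , ry)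
      ≤⟨ p≤p+q (0≤dist² (zx + zx , zy + zy) (px + rx , py + ry)) ⟩
    dist² (px , py) (rx , ry) + dist² (zx + zx , zy + zy) (px + rx , py + ry)
      ≡⟨ solve 6 (λ px py rx ry zx zy →
           (px :- rx) :* (px :- rx) :+ (py :- ry) :* (py :- ry) :+
           ((zx :+ zx :- (px :+ rx)) :* (zx :+ zx :- (px :+ rx)) :+ (zy :+ zy :- (py :+ ry)) :* (zy :+ zy :- (py :+ ry))) :=
           (zx :- px) :* (zx :- px) :+ (zy :- py) :* (zy :- py) :+ ((zx :- rx) :* (zx :- rx) :+ (zy :- ry) :* (zy :- ry)) :+
           ((zx :- px) :* (zx :- px) :+ (zy :- py) :* (zy :- py) :+ ((zx :- rx) :* (zx :- rx) :+ (zy :- ry) :* (zy :- ry))))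
         refl px py rx ry zx zy ⟩
    (dist² Z P + dist² Z R) + (dist² Z P + dist² Z R) ∎
    where
    open ≤-Reasoning
    P = px , py
    R = rx , ry
    Z = zx , zy

  disks-apart : ∀ P R → 1ℚ ≤ dist² P R → ∀ Z → dist² Z P < quarter → dist² Z R < quarter → ⊥
  disks-apart P R 1≤PR Z ZP<¼ ZR<¼ = <-irrefl refl (begin-strict
    1ℚ                                                 ≤⟨ 1≤PR ⟩
    dist² P R                                          ≤⟨ dist²≤double-sum P R Z ⟩
    (dist² Z P + dist² Z R) + (dist² Z P + dist² Z R)  <⟨ +-mono-< (+-mono-< ZP<¼ ZR<¼) (+-mono-< ZP<¼ ZR<¼) ⟩
    (quarter + quarter) + (quarter + quarter)          ≡⟨⟩
    1ℚ                                                 ∎)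
    where open ≤-Reasoning

  scale-injective : ∀ a b .{{_ : NonZero a}} .{{_ : NonZero b}} {P Q} → scale a b P ≡ scale a b Q → P ≡ Q
  scale-injective a b aP≡aQ = cong₂ _,_ (*-cancelˡ-≡ a (cong proj₁ aP≡aQ)) (*-cancelˡ-≡ b (cong proj₂ aP≡aQ))

  lerp-scale : ∀ a b P Q t → lerp (scale a b P) (scale a b Q) t ≡ scale a b (lerp P Q t)
  lerp-scale a b (px , py) (qx , qy) t = cong₂ _,_ (coordinate a px qx) (coordinate b py qy)
    where
    coordinate : ∀ a p q → a * p + t * (a * q - a * p) ≡ a * (p + t * (q - p))
    coordinate a p q = solve 4 (λ a p q t → a :* p :+ t :* (a :* q :- a :* p) := a :* (p :+ t :* (q :- p))) refl a p q t

  area-scale : ∀ a b P Q R → area (scale a b P) (scale a b Q) (scale a b R) ≡ a * b * area P Q R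
  area-scale a b (px , py) (qx , qy) (rx , ry) = solve 8 (λ a b px py qx qy rx ry →
      (a :* px :- a :* rx) :* (b :* qy :- b :* py) :- (b :* py :- b :* ry) :* (a :* qx :- a :* px) :=
      a :* b :* ((px :- rx) :* (qy :- py) :- (py :- ry) :* (qx :- px)))
    refl a b px py qx qy rx ry

  dist²-scale : ∀ a b P Q → dist² (scale a b P) (scale a b Q) ≡
    a * a * (proj₁ (P ⊖ Q) * proj₁ (P ⊖ Q)) + b * b * (proj₂ (P ⊖ Q) * proj₂ (P ⊖ Q))
  dist²-scale a b (px , py) (qx , qy) = solve 6 (λ a b px py qx qy →
      (a :* px :- a :* qx) :* (a :* px :- a :* qx) :+ (b :* py :- b :* qy) :* (b :* py :- b :* qy) :=
      a :* a :* ((px :- qx) :* (px :- qx)) :+ b :* b :* ((py :- qy) :* (py :- qy)))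
    refl a b px py qx qy

  dist²≤dist²-scale : ∀ {a b} P Q → 1ℚ ≤ a → 1ℚ ≤ b → dist² P Q ≤ dist² (scale a b P) (scale a b Q)
  dist²≤dist²-scale {a} {b} P Q 1≤a 1≤b = begin
    dist² P Q
      ≤⟨ +-mono-≤ (p≤q*p (1≤q⇒1≤q*q 1≤a) (0≤p*p (proj₁ (P ⊖ Q))))
                  (p≤q*p (1≤q⇒1≤q*q 1≤b) (0≤p*p (proj₂ (P ⊖ Q)))) ⟩
    a * a * (proj₁ (P ⊖ Q) * proj₁ (P ⊖ Q)) + b * b * (proj₂ (P ⊖ Q) * proj₂ (P ⊖ Q))
                                 ≡⟨ dist²-scale a b P Q ⟨
    dist² (scale a b P) (scale a b Q) ∎
    where open ≤-Reasoning

  stretched-area-dominates : ∀ {a b} P Q R →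
    proj₁ (Q ⊖ P) * proj₁ (Q ⊖ P) ≤ b * b → proj₂ (Q ⊖ P) * proj₂ (Q ⊖ P) ≤ a * a →
    1ℚ ≤ area P Q R * area P Q R →
    quarter * dist² (scale a b Q) (scale a b P) ≤
      area (scale a b P) (scale a b Q) (scale a b R) * area (scale a b P) (scale a b Q) (scale a b R)
  stretched-area-dominates {a} {b} P Q R dx²≤b² dy²≤a² 1≤C² = begin
    quarter * dist² (scale a b Q) (scale a b P)  ≤⟨ *-monoˡ-≤-nonNeg quarter L≤X+X ⟩
    quarter * (X + X)                            ≡⟨ solve 2 (λ q x → q :* (x :+ x) := (q :+ q) :* x) refl quarter X ⟩
    (quarter + quarter) * X
      ≤⟨ *-monoʳ-≤-nonNeg X {{nonNegative 0≤X}} (≤ᵇ⇒≤ {quarter + quarter} {1ℚ} _) ⟩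
    1ℚ * X                                       ≡⟨ *-identityˡ X ⟩
    X                                            ≤⟨ p≤q*p 1≤C² 0≤X ⟩
    C * C * X
      ≡⟨ solve 3 (λ a b c → c :* c :* (a :* a :* (b :* b)) := a :* b :* c :* (a :* b :* c)) refl a b C ⟩
    a * b * C * (a * b * C)                      ≡⟨ cong (λ z → z * z) (area-scale a b P Q R) ⟨
    area (scale a b P) (scale a b Q) (scale a b R) * area (scale a b P) (scale a b Q) (scale a b R) ∎
    where
    open ≤-Reasoning
    C = area P Q R
    X = a * a * (b * b)
    0≤X : 0ℚ ≤ X
    0≤X = 0≤p*q (0≤p*p a) (0≤p*p b)
    L≤X+X : dist² (scale a b Q) (scale a b P) ≤ X + X
    L≤X+X = begin
      dist² (scale a b Q) (scale a b P)  ≡⟨ dist²-scale a b Q P ⟩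
      a * a * (proj₁ (Q ⊖ P) * proj₁ (Q ⊖ P)) + b * b * (proj₂ (Q ⊖ P) * proj₂ (Q ⊖ P))
        ≤⟨ +-mono-≤ (*-monoˡ-≤-nonNeg (a * a) {{nonNegative (0≤p*p a)}} dx²≤b²)
                    (*-monoˡ-≤-nonNeg (b * b) {{nonNegative (0≤p*p b)}} dy²≤a²) ⟩
      a * a * (b * b) + b * b * (a * a)  ≡⟨ cong (X +_) (*-comm (b * b) (a * a)) ⟩
      X + X                              ∎

  stretched-segment-clear : ∀ {a b} P Q R → 1ℚ ≤ a → 1ℚ ≤ b →
    1ℚ ≤ dist² Q P → 1ℚ ≤ dist² P R → 1ℚ ≤ dist² Q R →
    proj₁ (Q ⊖ P) * proj₁ (Q ⊖ P) ≤ b * b → proj₂ (Q ⊖ P) * proj₂ (Q ⊖ P) ≤ a * a →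
    area P Q R ≡ 0ℚ ⊎ 1ℚ ≤ area P Q R * area P Q R →
    (∀ t → 0ℚ ≤ t → t ≤ 1ℚ → lerp P Q t ≢ R) →
    ∀ t → 0ℚ ≤ t → t ≤ 1ℚ → quarter ≤ dist² (lerp (scale a b P) (scale a b Q) t) (scale a b R)
  stretched-segment-clear {a} {b} P Q R 1≤a 1≤b 1≤QP 1≤PR 1≤QR dx²≤b² dy²≤a² (inj₂ 1≤C²) _ t _ _ =
    line-segment-clear (scale a b P) (scale a b Q) (scale a b R) 0<L
      (stretched-area-dominates {a} {b} P Q R dx²≤b² dy²≤a² 1≤C²) t
    where
    0<L : 0ℚ < dist² (scale a b Q) (scale a b P)
    0<L = 1≤p⇒0<p (≤-trans 1≤QP (dist²≤dist²-scale Q P 1≤a 1≤b))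
  stretched-segment-clear {a} {b} P Q R 1≤a 1≤b _ 1≤PR 1≤QR _ _ (inj₁ C≡0) misses =
    collinear-segment-clear (scale a b P) (scale a b Q) (scale a b R)
      (far 1≤PR (dist²≤dist²-scale P R 1≤a 1≤b)) (far 1≤QR (dist²≤dist²-scale Q R 1≤a 1≤b))
      (trans (area-scale a b P Q R) (trans (cong (a * b *_) C≡0) (*-zeroʳ (a * b))))
      stretched-misses
    where
    instance
      a≢0 : NonZero a
      a≢0 = >-nonZero (1≤p⇒0<p 1≤a)
      b≢0 : NonZero b
      b≢0 = >-nonZero (1≤p⇒0<p 1≤b)
    far : ∀ {d d′} → 1ℚ ≤ d → d ≤ d′ → quarter ≤ d′
    far 1≤d d≤d′ = ≤-trans (≤ᵇ⇒≤ {quarter} {1ℚ} _) (≤-trans 1≤d d≤d′)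
    stretched-misses : ∀ t → 0ℚ ≤ t → t ≤ 1ℚ → lerp (scale a b P) (scale a b Q) t ≢ scale a b R
    stretched-misses t 0≤t t≤1 hits = misses t 0≤t t≤1 (scale-injective a b (trans (sym (lerp-scale a b P Q t)) hits))


module IntegerGrid where

  open RationalPlane
  open import Data.Nat as ℕ using (ℕ; suc; zero)
  import Data.Nat.Coprimality as Coprime
  open import Data.Integer as ℤ using (ℤ; +_; -[1+_]; +[1+_]; 0ℤ; 1ℤ)
  import Data.Integer.Properties as ℤ
  open import Data.Rational as ℚ using (mkℚ; 0ℚ; 1ℚ)
  import Data.Rational.Properties as ℚ

  -- ι z = z / 1 is normalised through a gcd; in this literal form the
  -- homomorphism laws below hold by computation.
  ι≡mkℚ : ∀ z → ι z ≡ mkℚ z 0 (Coprime.sym (Coprime.1-coprimeTo ℤ.∣ z ∣))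
  ι≡mkℚ (+ n)    = ℚ.normalize-coprime (Coprime.sym (Coprime.1-coprimeTo n))
  ι≡mkℚ -[1+ n ] = cong ℚ.-_ (ℚ.normalize-coprime (Coprime.sym (Coprime.1-coprimeTo (suc n))))

  ι-homo-* : ∀ a b → ι (a ℤ.* b) ≡ ι a ℚ.* ι b
  ι-homo-* a b rewrite ι≡mkℚ a | ι≡mkℚ b = refl

  ι-homo-+ : ∀ a b → ι (a ℤ.+ b) ≡ ι a ℚ.+ ι b
  ι-homo-+ a b rewrite ι≡mkℚ a | ι≡mkℚ b | ℤ.*-identityʳ a | ℤ.*-identityʳ b = refl

  ι-homo-neg : ∀ a → ι (ℤ.- a) ≡ ℚ.- ι a
  ι-homo-neg a rewrite ι≡mkℚ a | ι≡mkℚ (ℤ.- a) with a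
  ... | + zero   = refl
  ... | +[1+ n ] = refl
  ... | -[1+ n ] = refl

  ι-homo-sub : ∀ a b → ι (a ℤ.- b) ≡ ι a ℚ.- ι b
  ι-homo-sub a b = trans (ι-homo-+ a (ℤ.- b)) (cong (ι a ℚ.+_) (ι-homo-neg b))

  ι-mono-≤ : ∀ {a b} → a ℤ.≤ b → ι a ℚ.≤ ι b
  ι-mono-≤ {a} {b} a≤b rewrite ι≡mkℚ a | ι≡mkℚ b =
    ℚ.*≤* (subst₂ ℤ._≤_ (sym (ℤ.*-identityʳ a)) (sym (ℤ.*-identityʳ b)) a≤b)

  1≤ι : ∀ A .{{_ : ℕ.NonZero A}} → 1ℚ ℚ.≤ ι (+ A)
  1≤ι (suc A) = ι-mono-≤ {1ℤ} {+ suc A} (ℤ.+≤+ (ℕ.s≤s ℕ.z≤n))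

  i≢0⇒1≤ι[i]² : ∀ i → i ≢ 0ℤ → 1ℚ ℚ.≤ ι i ℚ.* ι i
  i≢0⇒1≤ι[i]² i i≢0 = subst (1ℚ ℚ.≤_) (ι-homo-* i i) (ι-mono-≤ (1≤i*i i i≢0))
    where
    1≤i*i : ∀ i → i ≢ 0ℤ → 1ℤ ℤ.≤ i ℤ.* i
    1≤i*i (+ zero)  0≢0 = contradiction refl 0≢0
    1≤i*i +[1+ n ] _   = ℤ.+≤+ (ℕ.s≤s ℕ.z≤n)
    1≤i*i -[1+ n ] _   = ℤ.+≤+ (ℕ.s≤s ℕ.z≤n)

  1≤ι-diff² : ∀ {x y} → x ≢ y → 1ℚ ℚ.≤ (ι x ℚ.- ι y) ℚ.* (ι x ℚ.- ι y)
  1≤ι-diff² {x} {y} x≢y =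
    subst (λ d → 1ℚ ℚ.≤ d ℚ.* d) (ι-homo-sub x y) (i≢0⇒1≤ι[i]² (x ℤ.- y) (x≢y ∘ ℤ.i-j≡0⇒i≡j x y))

  ι-diff²≤ : ∀ {x y B} → y ℤ.- x ℤ.≤ + B → x ℤ.- y ℤ.≤ + B →
    (ι y ℚ.- ι x) ℚ.* (ι y ℚ.- ι x) ℚ.≤ ι (+ B) ℚ.* ι (+ B)
  ι-diff²≤ {x} {y} {B} y-x≤B x-y≤B = diff²≤ {ι x} {ι y} {ι (+ B)}
    (subst (ℚ._≤ ι (+ B)) (ι-homo-sub y x) (ι-mono-≤ y-x≤B))
    (subst (ℚ._≤ ι (+ B)) (ι-homo-sub x y) (ι-mono-≤ x-y≤B))

  1≤dist² : ∀ {P Q} → P ≢ Q → 1ℚ ℚ.≤ dist² (toQ P) (toQ Q)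
  1≤dist² {px , py} {qx , qy} P≢Q with px ℤ.≟ qx | py ℤ.≟ qy
  ... | no px≢qx | _        = ℚ.≤-trans (1≤ι-diff² px≢qx) (p≤p+q (0≤p*p (ι py ℚ.- ι qy)))
  ... | yes _    | no py≢qy = ℚ.≤-trans (1≤ι-diff² py≢qy) (p≤q+p (0≤p*p (ι px ℚ.- ι qx)))
  ... | yes refl | yes refl = contradiction refl P≢Q

  area-integral : ∀ P Q R → Σ ℤ λ c → area (toQ P) (toQ Q) (toQ R) ≡ ι c
  area-integral (px , py) (qx , qy) (rx , ry) =
    (px ℤ.- rx) ℤ.* (qy ℤ.- py) ℤ.- (py ℤ.- ry) ℤ.* (qx ℤ.- px) ,
    sym (trans (ι-homo-sub ((px ℤ.- rx) ℤ.* (qy ℤ.- py)) ((py ℤ.- ry) ℤ.* (qx ℤ.- px))) (cong₂ ℚ._-_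
      (trans (ι-homo-* (px ℤ.- rx) (qy ℤ.- py)) (cong₂ ℚ._*_ (ι-homo-sub px rx) (ι-homo-sub qy py)))
      (trans (ι-homo-* (py ℤ.- ry) (qx ℤ.- px)) (cong₂ ℚ._*_ (ι-homo-sub py ry) (ι-homo-sub qx px)))))

  integral-zero-or-≥1 : ∀ {q} → Σ ℤ (λ c → q ≡ ι c) → q ≡ 0ℚ ⊎ 1ℚ ℚ.≤ q ℚ.* q
  integral-zero-or-≥1 (c , q≡ιc) with c ℤ.≟ 0ℤ
  ... | yes refl = inj₁ q≡ιc
  ... | no c≢0   = inj₂ (subst (λ q → 1ℚ ℚ.≤ q ℚ.* q) (sym q≡ιc) (i≢0⇒1≤ι[i]² c c≢0))

  stretch : ℕ → ℕ → Point → Point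
  stretch A B (x , y) = + A ℤ.* x , + B ℤ.* y

  toQ-stretch : ∀ A B P → toQ (stretch A B P) ≡ scale (ι (+ A)) (ι (+ B)) (toQ P)
  toQ-stretch A B (x , y) = cong₂ _,_ (ι-homo-* (+ A) x) (ι-homo-* (+ B) y)

  stretch-injective : ∀ A B .{{_ : ℕ.NonZero A}} .{{_ : ℕ.NonZero B}} {P Q} →
    stretch A B P ≡ stretch A B Q → P ≡ Q
  stretch-injective A B {P} {Q} AP≡AQ = cong₂ _,_
    (ℤ.*-cancelˡ-≡ (+ A) (proj₁ P) (proj₁ Q) (cong proj₁ AP≡AQ))
    (ℤ.*-cancelˡ-≡ (+ B) (proj₂ P) (proj₂ Q) (cong proj₂ AP≡AQ))

  stretch-segment-clear : ∀ A B .{{_ : ℕ.NonZero A}} .{{_ : ℕ.NonZero B}} U V Z →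
    V ≢ U → U ≢ Z → V ≢ Z → ¬ OnSegment U V Z →
    xc V ℤ.- xc U ℤ.≤ + B → xc U ℤ.- xc V ℤ.≤ + B →
    yc V ℤ.- yc U ℤ.≤ + A → yc U ℤ.- yc V ℤ.≤ + A →
    ¬ SegmentHitsDisk (stretch A B U) (stretch A B V) (stretch A B Z)
  stretch-segment-clear A B U V Z V≢U U≢Z V≢Z off-segment dx≤B -dx≤B dy≤A -dy≤A (t , 0≤t , t≤1 , hits) =
    ℚ.<-irrefl refl (ℚ.<-≤-trans hits clear)
    -- along U V t is definitionally lerp (toQ U) (toQ V) t.
    where
    clear : quarter ℚ.≤ dist² (lerp (toQ (stretch A B U)) (toQ (stretch A B V)) t) (toQ (stretch A B Z))
    clear = subst (λ (P , Q , R) → quarter ℚ.≤ dist² (lerp P Q t) R)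
      (sym (cong₂ _,_ (toQ-stretch A B U) (cong₂ _,_ (toQ-stretch A B V) (toQ-stretch A B Z))))
      (stretched-segment-clear {ι (+ A)} {ι (+ B)} (toQ U) (toQ V) (toQ Z) (1≤ι A) (1≤ι B)
        (1≤dist² V≢U) (1≤dist² U≢Z) (1≤dist² V≢Z)
        (ι-diff²≤ {xc U} {xc V} dx≤B -dx≤B) (ι-diff²≤ {yc U} {yc V} dy≤A -dy≤A)
        (integral-zero-or-≥1 (area-integral U V Z))
        (λ s 0≤s s≤1 e → off-segment (s , 0≤s , s≤1 , e)) t 0≤t t≤1)


open RationalPlane using (disks-apart)
open IntegerGrid
open import Data.Nat using (ℕ; zero; suc; _*_)
import Data.Nat as ℕ
import Data.Nat.Properties as ℕ
open import Data.Integer as ℤ using (+_; 1ℤ)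
import Data.Integer.Properties as ℤ
open import Data.Integer.Tactic.RingSolver using (solve-∀)
open import Data.Fin using (Fin)

spread≤ : ∀ {x₀ u v} N → x₀ ℤ.≤ u → v ℤ.≤ x₀ ℤ.+ (+ N ℤ.- 1ℤ) → v ℤ.- u ℤ.≤ + N
spread≤ {x₀} {u} {v} N x₀≤u v≤ = begin
  v ℤ.- u                           ≤⟨ ℤ.+-mono-≤ v≤ (ℤ.neg-mono-≤ x₀≤u) ⟩
  x₀ ℤ.+ (+ N ℤ.- 1ℤ) ℤ.- x₀        ≡⟨ cancel x₀ (+ N) ⟩
  + N ℤ.- 1ℤ                        ≤⟨ ℤ.i-j≤i (+ N) 1ℤ ⟩
  + N                               ∎
  where
  open ℤ.≤-Reasoning
  cancel : ∀ a n → a ℤ.+ (n ℤ.- 1ℤ) ℤ.- a ≡ n ℤ.- 1ℤ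
  cancel = solve-∀

side-nonZero : ∀ {x₀ x} N → x₀ ℤ.≤ x → x ℤ.≤ x₀ ℤ.+ (+ N ℤ.- 1ℤ) → ℕ.NonZero N
side-nonZero (suc N) _ _ = _
side-nonZero {x₀} zero x₀≤x x≤x₀-1 = contradiction
  (ℤ.i≤pred[j]⇒i<j (subst (x₀ ℤ.≤_) (ℤ.+-comm x₀ ℤ.-1ℤ) (ℤ.≤-trans x₀≤x x≤x₀-1))) (ℤ.<-irrefl refl)

stretch-≤ : ∀ A N .{{_ : ℕ.NonZero A}} {x₀ x} → x ℤ.≤ x₀ ℤ.+ (+ N ℤ.- 1ℤ) →
  + A ℤ.* x ℤ.≤ + A ℤ.* x₀ ℤ.+ (+ (A * N) ℤ.- 1ℤ)
stretch-≤ A N {x₀} {x} x≤ = begin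
  + A ℤ.* x                                   ≤⟨ ℤ.*-monoˡ-≤-nonNeg (+ A) x≤ ⟩
  + A ℤ.* (x₀ ℤ.+ (+ N ℤ.- 1ℤ))               ≡⟨ distrib (+ A) x₀ (+ N) ⟩
  + A ℤ.* x₀ ℤ.+ (+ A ℤ.* + N ℤ.- + A)         ≡⟨ cong (λ z → + A ℤ.* x₀ ℤ.+ (z ℤ.- + A)) (ℤ.pos-* A N) ⟨
  + A ℤ.* x₀ ℤ.+ (+ (A * N) ℤ.- + A)
    ≤⟨ ℤ.+-monoʳ-≤ (+ A ℤ.* x₀) (ℤ.+-monoʳ-≤ (+ (A * N)) (ℤ.neg-mono-≤ (ℤ.+≤+ (ℕ.>-nonZero⁻¹ A)))) ⟩
  + A ℤ.* x₀ ℤ.+ (+ (A * N) ℤ.- 1ℤ)          ∎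
  where
  open ℤ.≤-Reasoning
  distrib : ∀ a x n → a ℤ.* (x ℤ.+ (n ℤ.- 1ℤ)) ≡ a ℤ.* x ℤ.+ (a ℤ.* n ℤ.- a)
  distrib = solve-∀

stretch-fits : ∀ {m} A B {W H} .{{_ : ℕ.NonZero A}} .{{_ : ℕ.NonZero B}} (p : Fin m → Point) →
  FitsInGrid W H p → FitsInGrid (A * W) (B * H) (stretch A B ∘ p)
stretch-fits A B {W} {H} p (x₀ , y₀ , inside) = + A ℤ.* x₀ , + B ℤ.* y₀ , λ v →
  let x₀≤x , x≤ , y₀≤y , y≤ = inside v in
  ℤ.*-monoˡ-≤-nonNeg (+ A) x₀≤x , stretch-≤ A W x≤ , ℤ.*-monoˡ-≤-nonNeg (+ B) y₀≤y , stretch-≤ B H y≤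

stretch-disk-link : ∀ G (p : Fin (n G) → Point) {W H} A B .{{_ : ℕ.NonZero A}} .{{_ : ℕ.NonZero B}} →
  IsGridDrawing G p → FitsInGrid W H p → W ℕ.≤ B → H ℕ.≤ A → IsDiskLinkDrawing G (stretch A B ∘ p)
stretch-disk-link G p {W} {H} A B (p-injective , off-segment) (_ , _ , inside) W≤B H≤A =
  q-injective ,
  (λ u v u≢v (Z , in-u , in-v) → disks-apart (toQ (q u)) (toQ (q v)) (1≤dist² (q-distinct u≢v)) Z in-u in-v) ,
  λ u v w uv w≢u w≢v → stretch-segment-clear A B (p u) (p v) (p w)
    (p-distinct (v≢u uv)) (p-distinct (w≢u ∘ sym)) (p-distinct (w≢v ∘ sym)) (off-segment u v w uv w≢u w≢v)
    (x-spread u v) (x-spread v u) (y-spread u v) (y-spread v u)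
  where
  q = stretch A B ∘ p
  q-injective : Injective q
  q-injective u v qu≡qv = p-injective u v (stretch-injective A B qu≡qv)
  q-distinct : ∀ {u v} → u ≢ v → q u ≢ q v
  q-distinct u≢v = u≢v ∘ q-injective _ _
  p-distinct : ∀ {u v} → u ≢ v → p u ≢ p v
  p-distinct u≢v = u≢v ∘ p-injective _ _
  v≢u : ∀ {u v} → Adj G u v → v ≢ u
  v≢u uv refl = irrefl G uv
  x-spread : ∀ u v → xc (p v) ℤ.- xc (p u) ℤ.≤ + B
  x-spread u v with inside u | inside v
  ... | x₀≤xu , _ | _ , xv≤ , _ = ℤ.≤-trans (spread≤ W x₀≤xu xv≤) (ℤ.+≤+ W≤B)
  y-spread : ∀ u v → yc (p v) ℤ.- yc (p u) ℤ.≤ + A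
  y-spread u v with inside u | inside v
  ... | _ , _ , y₀≤yu , _ | _ , _ , _ , yv≤ = ℤ.≤-trans (spread≤ H y₀≤yu yv≤) (ℤ.+≤+ H≤A)

theorem2 : (G : Graph) (W H : ℕ) (p : Fin (n G) → Point) →
    IsGridDrawing G p → OnGridOfSize W H p →
    Σ (Fin (n G) → Point) λ q →
      IsDiskLinkDrawing G q × FitsInGrid (2 * H * W) (2 * H * W) q
theorem2 G W H p grid (x₀ , y₀ , inside , (left , _) , _ , (bottom , _) , _) =
  stretch (2 * H) (2 * W) ∘ p ,
  stretch-disk-link G p (2 * H) (2 * W) grid box (ℕ.m≤n*m W 2) (ℕ.m≤n*m H 2) ,
  subst (λ h → FitsInGrid (2 * H * W) h (stretch (2 * H) (2 * W) ∘ p)) 2WH≡2HW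
    (stretch-fits (2 * H) (2 * W) p box)
  where
  box : FitsInGrid W H p
  box = x₀ , y₀ , inside
  instance
    W≢0 : ℕ.NonZero W
    W≢0 = let x₀≤x , x≤ , _ = inside left in side-nonZero W x₀≤x x≤
    H≢0 : ℕ.NonZero H
    H≢0 = let _ , _ , y₀≤y , y≤ = inside bottom in side-nonZero H y₀≤y y≤
    2H≢0 : ℕ.NonZero (2 * H)
    2H≢0 = ℕ.m*n≢0 2 H
    2W≢0 : ℕ.NonZero (2 * W)
    2W≢0 = ℕ.m*n≢0 2 W
  2WH≡2HW : 2 * W * H ≡ 2 * H * W
  2WH≡2HW = trans (ℕ.*-assoc 2 W H) (trans (cong (2 *_) (ℕ.*-comm W H)) (sym (ℕ.*-assoc 2 H W)))
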